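{- For the loop $W(t,B)$ with precondition $P$ and postcondition $Q$: $I$ is a correct invariant if and only if $I$ is a safe invariant and $R$ is a correct summary, where $R(s,s_n) :\equiv I(s)\implies Q(s_n)$.
   Context: States form a set $S$; commands are relations $C\subseteq S\times\hat S$ with $\hat S = S \uplus \{\mathsf{err}\} \uplus \{\mathrm{brk}(s)\mid s\in S\}$ ($\mathsf{err}$: runtime error outcome; $\mathrm{brk}(s)$: early loop exit via break in state $s$). The loop has test $t\subseteq S$ and body $B\subseteq S\times\hat S$. Invariant $I\subseteq S$ w.r.t. $P$: $P(s_0)\implies I(s_0)$ and $I(s)\land t(s)\land B(s,s')\implies I(s')$; safe: also $I(s)\land t(s)\land B(s,\mathsf{err})\implies\mathit{false}$; correct w.r.t. $Q$: safe and also $I(s)\land t(s)\land B(s,\mathrm{brk}(s_n))\implies Q(s_n)$ and $I(s_n)\land\lnot t(s_n)\implies Q(s_n)$. Summary $R\subseteq S\times S$: $\lnot t(s_n)\implies R(s_n,s_n)$, $t(s)\land B(s,\mathrm{brk}(s_n))\implies R(s,s_n)$, $t(s)\land B(s,s')\land R(s',s_n)\implies R(s,s_n)$; correct w.r.t. $P,Q$: also $P(s_0)\land R(s_0,s_n)\implies Q(s_n)$. -}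

module Defs where

open import Data.Product using (_×_; _,_)
open import Data.Empty using (⊥)

data Ŝ (S : Set) : Set where
  ok  : S → Ŝ S
  err : Ŝ S
  brk : S → Ŝ S

Pred : Set → Set₁
Pred S = S → Set

Rel : Set → Set₁
Rel S = S → S → Set

Cmd : Set → Set₁
Cmd S = S → Ŝ S → Set

module Loop {S : Set} (t : Pred S) (B : Cmd S) where

  IsInvariant : Pred S → Pred S → Set
  IsInvariant P I =
    (∀ s₀ → P s₀ → I s₀) ×
    (∀ s s' → I s → t s → B s (ok s') → I s')

  IsSafeInvariant : Pred S → Pred S → Set
  IsSafeInvariant P I =
    IsInvariant P I × (∀ s → I s → t s → B s err → ⊥)

  IsCorrectInvariant : Pred S → Pred S → Pred S → Set
  IsCorrectInvariant P Q I =
    IsSafeInvariant P I ×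
    (∀ s sₙ → I s → t s → B s (brk sₙ) → Q sₙ) ×
    (∀ sₙ → I sₙ → (t sₙ → ⊥) → Q sₙ)

  IsSummary : Rel S → Set
  IsSummary R =
    (∀ sₙ → (t sₙ → ⊥) → R sₙ sₙ) ×
    (∀ s sₙ → t s → B s (brk sₙ) → R s sₙ) ×
    (∀ s s' sₙ → t s → B s (ok s') → R s' sₙ → R s sₙ)

  IsCorrectSummary : Pred S → Pred S → Rel S → Set
  IsCorrectSummary P Q R =
    IsSummary R × (∀ s₀ sₙ → P s₀ → R s₀ sₙ → Q sₙ)

module Submission where

-- With R s sₙ := I s → Q sₙ, the three summary clauses are exactly the two
-- correctness clauses of I (break and exit) plus preservation of I by the body,
-- and correctness of R is the initiation clause P ⇒ I.  Conversely the break and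
-- exit clauses of R give back the correctness clauses of I.

open import Defs
open import Data.Product using (_×_; _,_)
open import Function.Bundles using (_⇔_; mk⇔)

module _ {S : Set} (t : Pred S) (B : Cmd S) (P Q I : Pred S) where

  open Loop t B

  InvariantImpliesPost : Rel S
  InvariantImpliesPost s sₙ = I s → Q sₙ

  correctInvariant⇒summary : IsCorrectInvariant P Q I → IsSummary InvariantImpliesPost
  correctInvariant⇒summary (((_ , preserved) , _) , breakQ , exitQ) =
      (λ sₙ ¬ts Is → exitQ sₙ Is ¬ts)
    , (λ s sₙ ts brk Is → breakQ s sₙ Is ts brk)
    , (λ s s' sₙ ts step R' Is → R' (preserved s s' Is ts step))

  invariant⇒summary-correct : IsInvariant P I →
                              ∀ s₀ sₙ → P s₀ → InvariantImpliesPost s₀ sₙ → Q sₙ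
  invariant⇒summary-correct (initial , _) s₀ _ Ps₀ R = R (initial s₀ Ps₀)

  summary⇒correctInvariant : IsSafeInvariant P I → IsSummary InvariantImpliesPost →
                             IsCorrectInvariant P Q I
  summary⇒correctInvariant safe (exitR , breakR , _) =
      safe
    , (λ s sₙ Is ts brk → breakR s sₙ ts brk Is)
    , (λ sₙ Is ¬ts → exitR sₙ ¬ts Is)

proposition2 : {S : Set} (t : Pred S) (B : Cmd S) (P Q I : Pred S) →
    Loop.IsCorrectInvariant t B P Q I
    ⇔ (Loop.IsSafeInvariant t B P I × Loop.IsCorrectSummary t B P Q (λ s sₙ → I s → Q sₙ))
proposition2 t B P Q I = mk⇔ to from
  where
  to : Loop.IsCorrectInvariant t B P Q I →
       Loop.IsSafeInvariant t B P I × Loop.IsCorrectSummary t B P Q (InvariantImpliesPost t B P Q I)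
  to correct@((invariant , safe) , _) =
    (invariant , safe) ,
    correctInvariant⇒summary t B P Q I correct ,
    invariant⇒summary-correct t B P Q I invariant
  from : Loop.IsSafeInvariant t B P I × Loop.IsCorrectSummary t B P Q (InvariantImpliesPost t B P Q I) →
         Loop.IsCorrectInvariant t B P Q I
  from (safe , summary , _) = summary⇒correctInvariant t B P Q I safe summary
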